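{- Let $G$ be a connected graph of order $n$ with diameter $d$ and radius $r$, and let $Z(G)=\{x_1,\ldots,x_t\}$ ($t\geqslant 1$) be the center of $G$. Then for every integer $i$ with $0\leqslant i\leqslant d-r$, $$D(G^{r+i})\geqslant \big|\{x\in V(G) : 0\leqslant d_G(x_j,x)\leqslant i \text{ for some } j\in\{1,\ldots,t\}\}\big|.$$
   Context: All graphs are finite and simple. The eccentricity of a vertex $x$ is $\max_{u\in V(G)} d_G(x,u)$; the radius and diameter are the minimum and maximum eccentricities; the center $Z(G)$ is the set of vertices of eccentricity equal to the radius. The distinguishing number $D(H)$ is the least $d$ such that some labeling $V(H)\to\{1,\dots,d\}$ is preserved by no non-trivial automorphism of $H$. The $m$-th power $G^m$ is the graph on $V(G)$ in which distinct $x,y$ are adjacent iff $1\leqslant d_G(x,y)\leqslant m$. -}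

module Defs where

open import Data.Nat using (ℕ; zero; suc; _≤_; _∸_; _+_)
open import Data.Fin using (Fin)
open import Data.Fin.Subset using (Subset; _∈_; ∣_∣)
open import Data.Fin.Permutation using (Permutation′; _⟨$⟩ʳ_)
open import Data.Product using (Σ; ∃; _×_; _,_)
open import Relation.Binary.PropositionalEquality using (_≡_; _≢_)
open import Relation.Nullary using (¬_)
open import Function.Bundles using (_⇔_)

record Graph (n : ℕ) : Set₁ where
  field
    Adj     : Fin n → Fin n → Set
    symAdj  : ∀ {x y} → Adj x y → Adj y x
    irrefl  : ∀ {x} → ¬ Adj x x
open Graph public

data Walk {n : ℕ} (G : Graph n) : Fin n → Fin n → ℕ → Set where
  nil  : ∀ x → Walk G x x 0
  cons : ∀ {x y z k} → Adj G x y → Walk G y z k → Walk G x z (suc k)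

Connected : ∀ {n} → Graph n → Set
Connected G = ∀ x y → ∃ λ k → Walk G x y k

Dist : ∀ {n} → Graph n → Fin n → Fin n → ℕ → Set
Dist G x y k = Walk G x y k × (∀ m → Walk G x y m → k ≤ m)

Ecc : ∀ {n} → Graph n → Fin n → ℕ → Set
Ecc G x e = (∀ u k → Dist G x u k → k ≤ e) × (∃ λ u → Dist G x u e)

IsRadius : ∀ {n} → Graph n → ℕ → Set
IsRadius G r = (∃ λ x → Ecc G x r) × (∀ y e → Ecc G y e → r ≤ e)

IsDiameter : ∀ {n} → Graph n → ℕ → Set
IsDiameter G d = (∃ λ x → Ecc G x d) × (∀ y e → Ecc G y e → e ≤ d)

-- x is in the center Z(G) when ecc(x) = rad(G) = r.
InCenter : ∀ {n} → Graph n → ℕ → Fin n → Set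
InCenter G r x = Ecc G x r

Power : ∀ {n} → Graph n → ℕ → Graph n
Power {n} G m = record
  { Adj = PAdj
  ; symAdj = λ { (k , (w , mn) , 1≤k , k≤m) → k , (rev w , λ m' w' → mn m' (rev w')) , 1≤k , k≤m }
  ; irrefl = λ { (k , (w , mn) , 1≤k , k≤m) → no0 1≤k (mn 0 (nil _)) }
  }
  where
  PAdj : Fin n → Fin n → Set
  PAdj x y = ∃ λ k → Dist G x y k × 1 ≤ k × k ≤ m
  snoc : ∀ {x y z k} → Walk G x y k → Adj G y z → Walk G x z (suc k)
  snoc (nil _) a = cons a (nil _)
  snoc (cons a w) b = cons a (snoc w b)
  rev : ∀ {x y k} → Walk G x y k → Walk G y x k
  rev (nil x) = nil x
  rev (cons a w) = snoc (rev w) (symAdj G a)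
  no0 : ∀ {k} → 1 ≤ k → ¬ (k ≤ 0)
  no0 (Data.Nat.s≤s _) ()

IsAutomorphism : ∀ {n} → Graph n → Permutation′ n → Set
IsAutomorphism G π = ∀ x y → Adj G x y ⇔ Adj G (π ⟨$⟩ʳ x) (π ⟨$⟩ʳ y)

IsDistinguishingLabeling : ∀ {n} → Graph n → (d : ℕ) → (Fin n → Fin d) → Set
IsDistinguishingLabeling G d f =
  ∀ π → IsAutomorphism G π → (∀ x → f (π ⟨$⟩ʳ x) ≡ f x) → ∀ x → π ⟨$⟩ʳ x ≡ x

Distinguishable : ∀ {n} → Graph n → ℕ → Set
Distinguishable {n} G d = Σ (Fin n → Fin d) (IsDistinguishingLabeling G d)

IsDistinguishingNumber : ∀ {n} → Graph n → ℕ → Set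
IsDistinguishingNumber G D = Distinguishable G D × (∀ d → Distinguishable G d → D ≤ d)

NearCenter : ∀ {n} → Graph n → (r i : ℕ) → Fin n → Set
NearCenter G r i x = ∃ λ z → InCenter G r z × ∃ λ k → Dist G z x k × k ≤ i

-- A vertex x within distance i of a centre vertex z has eccentricity at most
-- r + i, so in G^(r+i) it is adjacent to every other vertex.  Swapping two such
-- universal vertices is an automorphism of G^(r+i), hence a distinguishing
-- labeling separates them and is injective on the set S.  Only ecc(z) = r is
-- used.
-- Adjacency is not decidable, so distances exist only under a double negation;
-- this suffices because the conclusion ∣ S ∣ ≤ D is decidable.
module Submission where

open import Defs
open import Data.Nat using (ℕ; _≤_; _∸_; _+_)
open import Data.Fin.Subset using (Subset; _∈_; ∣_∣)
open import Function.Bundles using (_⇔_)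

open import Data.Nat using (zero; suc; z≤n; s≤s; _<_; _≤?_)
open import Data.Nat.Properties
  using (≤-trans; ≤-reflexive; +-mono-≤; +-comm; ≮⇒≥; n<1+n; m<1+n⇒m<n∨m≡n)
open import Data.Fin using (Fin; punchOut)
open import Data.Fin.Properties using (suc-injective; punchOut-injective; _≟_)
open import Data.Fin.Permutation using (_⟨$⟩ʳ_; transpose)
open import Data.Fin.Subset using (inside; outside)
open import Data.Vec using (_∷_; []; here; there)
open import Data.Product using (∃; _×_; _,_; proj₂)
open import Data.Sum using (_⊎_; inj₁; inj₂; [_,_])
open import Function using (id; _∘′_)
open import Function.Bundles using (mk⇔; Equivalence; Injection)
open import Function.Properties.Inverse using (↔⇒↣)
open import Relation.Nullary using (¬_; yes; no)
open import Relation.Nullary.Decidable using (decidable-stable; ¬¬-excluded-middle)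
open import Relation.Nullary.Negation using (¬¬-map; contradiction)
open import Relation.Binary.PropositionalEquality using (_≡_; _≢_; refl; sym; trans; cong)

∣p∣≤-injection : ∀ {n m} (p : Subset n) (f : ∀ {x} → x ∈ p → Fin m) →
                 (∀ {x y} (x∈p : x ∈ p) (y∈p : y ∈ p) → f x∈p ≡ f y∈p → x ≡ y) →
                 ∣ p ∣ ≤ m
∣p∣≤-injection []            f inj = z≤n
∣p∣≤-injection (outside ∷ p) f inj =
  ∣p∣≤-injection p (λ x∈p → f (there x∈p)) (λ x∈p y∈p e → suc-injective (inj _ _ e))
∣p∣≤-injection {m = zero}  (inside ∷ p) f inj with () ← f here
∣p∣≤-injection {m = suc m} (inside ∷ p) f inj = s≤s (∣p∣≤-injection p g g-injective)
  where
  f₀≢f : ∀ {x} (x∈p : x ∈ p) → f here ≢ f (there x∈p)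
  f₀≢f x∈p e with () ← inj here (there x∈p) e
  g : ∀ {x} → x ∈ p → Fin m
  g x∈p = punchOut (f₀≢f x∈p)
  g-injective : ∀ {x y} (x∈p : x ∈ p) (y∈p : y ∈ p) → g x∈p ≡ g y∈p → x ≡ y
  g-injective x∈p y∈p e =
    suc-injective (inj _ _ (punchOut-injective (f₀≢f x∈p) (f₀≢f y∈p) e))

Least : (ℕ → Set) → Set
Least P = ∃ λ k → P k × (∀ j → P j → k ≤ j)

¬¬-least : ∀ {P : ℕ → Set} {m} → P m → ¬ ¬ Least P
¬¬-least {P} {m} Pm ¬least =
  leastOrNone (suc m) [ ¬least , (λ none → none m (n<1+n m) Pm) ]
  where
  leastOrNone : ∀ m → ¬ ¬ (Least P ⊎ (∀ j → j < m → ¬ P j))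
  leastOrNone zero    k = k (inj₂ (λ _ ()))
  leastOrNone (suc m) k = leastOrNone m λ
    { (inj₁ least) → k (inj₁ least)
    ; (inj₂ none)  → ¬¬-excluded-middle λ
        { (yes Pm) → k (inj₁ (m , Pm , λ j Pj → ≮⇒≥ (λ j<m → none j j<m Pj)))
        ; (no ¬Pm) → k (inj₂ (λ j j<1+m →
            [ none j , (λ { refl → ¬Pm }) ] (m<1+n⇒m<n∨m≡n j<1+m)))
        } }

¬¬-shift-Fin : ∀ n {P : Fin n → Set} → (∀ x → ¬ ¬ P x) → ¬ ¬ (∀ x → P x)
¬¬-shift-Fin zero    h k = k (λ ())
¬¬-shift-Fin (suc n) h k = h Fin.zero λ P₀ → ¬¬-shift-Fin n (λ x → h (Fin.suc x)) λ Pₛ →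
  k λ { Fin.zero → P₀ ; (Fin.suc x) → Pₛ x }

module _ {n : ℕ} {G : Graph n} where

  snoc : ∀ {x y z k} → Walk G x y k → Adj G y z → Walk G x z (suc k)
  snoc (nil _)    a = cons a (nil _)
  snoc (cons a w) b = cons a (snoc w b)

  reverse : ∀ {x y k} → Walk G x y k → Walk G y x k
  reverse (nil x)    = nil x
  reverse (cons a w) = snoc (reverse w) (symAdj G a)

  _++_ : ∀ {x y z k l} → Walk G x y k → Walk G y z l → Walk G x z (k + l)
  nil _    ++ w = w
  cons a v ++ w = cons a (v ++ w)

  walk-length-0 : ∀ {x y} → Walk G x y 0 → x ≡ y
  walk-length-0 (nil _) = refl

  dist-triangle : ∀ {x y z k l m} → Dist G z x k → Dist G z y l → Dist G x y m → m ≤ k + l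
  dist-triangle (wzx , _) (wzy , _) (_ , minimal) = minimal _ (reverse wzx ++ wzy)

AllDistances : ∀ {n} → Graph n → Set
AllDistances G = ∀ x y → ∃ (Dist G x y)

-- ∃ (Dist G x y) is by definition Least (Walk G x y).
¬¬-allDistances : ∀ {n} {G : Graph n} → Connected G → ¬ ¬ AllDistances G
¬¬-allDistances {n} conn =
  ¬¬-shift-Fin n λ x → ¬¬-shift-Fin n λ y → ¬¬-least (proj₂ (conn x y))

Universal : ∀ {n} → Graph n → Fin n → Set
Universal H x = ∀ y → x ≢ y → Adj H x y

module _ {n : ℕ} (H : Graph n) where

  adj⇔≢ : ∀ {x y} → Universal H x ⊎ Universal H y → Adj H x y ⇔ x ≢ y
  adj⇔≢ {x} {y} x∨y-universal = mk⇔ adj⇒≢ ≢⇒adj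
    where
    adj⇒≢ : Adj H x y → x ≢ y
    adj⇒≢ a refl = irrefl H a
    ≢⇒adj : x ≢ y → Adj H x y
    ≢⇒adj x≢y = [ (λ x-universal → x-universal y x≢y)
                , (λ y-universal → symAdj H (y-universal x (x≢y ∘′ sym))) ] x∨y-universal

  module _ {u v : Fin n} (u-universal : Universal H u) (v-universal : Universal H v) where

    private
      τ = transpose u v

      OneOf : Fin n → Set
      OneOf x = x ≡ u ⊎ x ≡ v

      oneOf-universal : ∀ {x} → OneOf x → Universal H x
      oneOf-universal (inj₁ refl) = u-universal
      oneOf-universal (inj₂ refl) = v-universal

      fixed-or-swapped : ∀ x → τ ⟨$⟩ʳ x ≡ x ⊎ (OneOf x × OneOf (τ ⟨$⟩ʳ x))
      fixed-or-swapped x with x ≟ u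
      ... | yes x≡u = inj₂ (inj₁ x≡u , inj₂ refl)
      ... | no _ with x ≟ v
      ...   | yes x≡v = inj₂ (inj₂ x≡v , inj₁ refl)
      ...   | no _    = inj₁ refl

      ≢⇔τ≢ : ∀ {x y} → x ≢ y ⇔ τ ⟨$⟩ʳ x ≢ τ ⟨$⟩ʳ y
      ≢⇔τ≢ = mk⇔ (λ x≢y e → x≢y (Injection.injective (↔⇒↣ τ) e)) (λ τx≢τy e → τx≢τy (cong (τ ⟨$⟩ʳ_) e))

      via≢ : ∀ {x y} → Universal H x ⊎ Universal H y →
             Universal H (τ ⟨$⟩ʳ x) ⊎ Universal H (τ ⟨$⟩ʳ y) →
             Adj H x y ⇔ Adj H (τ ⟨$⟩ʳ x) (τ ⟨$⟩ʳ y)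
      via≢ before after = mk⇔
        (λ a → from (adj⇔≢ after) (to ≢⇔τ≢ (to (adj⇔≢ before) a)))
        (λ a → from (adj⇔≢ before) (from ≢⇔τ≢ (to (adj⇔≢ after) a)))
        where open Equivalence

    transpose-isAutomorphism : IsAutomorphism H τ
    transpose-isAutomorphism x y with fixed-or-swapped x | fixed-or-swapped y
    ... | inj₂ (x∈ , τx∈) | _               = via≢ (inj₁ (oneOf-universal x∈)) (inj₁ (oneOf-universal τx∈))
    ... | inj₁ _          | inj₂ (y∈ , τy∈) = via≢ (inj₂ (oneOf-universal y∈)) (inj₂ (oneOf-universal τy∈))
    ... | inj₁ τx≡x       | inj₁ τy≡y rewrite τx≡x | τy≡y = mk⇔ id id

    transpose-preserves : ∀ {d} (f : Fin n → Fin d) → f u ≡ f v → ∀ x → f (τ ⟨$⟩ʳ x) ≡ f x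
    transpose-preserves f fu≡fv x with fixed-or-swapped x
    ... | inj₁ τx≡x       = cong f τx≡x
    ... | inj₂ (x∈ , τx∈) = trans (label≡fu τx∈) (sym (label≡fu x∈))
      where
      label≡fu : ∀ {c} → OneOf c → f c ≡ f u
      label≡fu (inj₁ refl) = refl
      label≡fu (inj₂ refl) = sym fu≡fv

    distinguishing⇒separates-universal : ∀ {d} {f : Fin n → Fin d} →
      IsDistinguishingLabeling H d f → f u ≡ f v → u ≡ v
    distinguishing⇒separates-universal {f = f} distinguishing fu≡fv =
      trans (sym (distinguishing τ transpose-isAutomorphism (transpose-preserves f fu≡fv) u)) τu≡v
      where
      τu≡v : τ ⟨$⟩ʳ u ≡ v
      τu≡v with u ≟ u
      ... | yes _   = refl
      ... | no u≢u = contradiction refl u≢u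

nearCenter⇒universal : ∀ {n} {G : Graph n} → AllDistances G →
  ∀ {r i x} → NearCenter G r i x → Universal (Power G (r + i)) x
nearCenter⇒universal {G = G} distances {r} {i} {x} (z , (ecc-bound , _) , k , Dzx , k≤i) y x≢y
  with distances x y | distances z y
... | m , Dxy@(wxy , _) | l , Dzy = m , Dxy , positive wxy , m≤r+i
  where
  positive : ∀ {m} → Walk G x y m → 1 ≤ m
  positive {zero}  w = contradiction (walk-length-0 w) x≢y
  positive {suc m} w = s≤s z≤n
  m≤r+i : m ≤ r + i
  m≤r+i = ≤-trans (dist-triangle Dzx Dzy Dxy)
                  (≤-trans (+-mono-≤ k≤i (ecc-bound y l Dzy)) (≤-reflexive (+-comm i r)))

theorem2p4 : ∀ (n : ℕ) (G : Graph n) → Connected G →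
    ∀ (d r : ℕ) → IsDiameter G d → IsRadius G r →
    ∀ (i : ℕ) → i ≤ d ∸ r →
    ∀ (DG : ℕ) → IsDistinguishingNumber (Power G (r + i)) DG →
    ∀ (S : Subset n) → (∀ x → (x ∈ S) ⇔ NearCenter G r i x) →
    ∣ S ∣ ≤ DG
theorem2p4 n G connected _ r _ _ i _ DG ((f , distinguishing) , _) S S⇔near =
  decidable-stable (∣ S ∣ ≤? DG) (¬¬-map bound (¬¬-allDistances connected))
  where
  bound : AllDistances G → ∣ S ∣ ≤ DG
  bound distances = ∣p∣≤-injection S (λ {x} _ → f x) λ x∈S y∈S →
    distinguishing⇒separates-universal (Power G (r + i))
      (universal x∈S) (universal y∈S) distinguishing
    where
    universal : ∀ {x} → x ∈ S → Universal (Power G (r + i)) x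
    universal {x} x∈S = nearCenter⇒universal distances (Equivalence.to (S⇔near x) x∈S)
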